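{- Let $Q\ge3$, let $S_Q:=\#\mathfrak{SF}_Q$, and enumerate $\mathfrak{SF}_Q$ increasingly as $\gamma_1<\gamma_2<\cdots<\gamma_{S_Q}=1/1$, with $\gamma_i=a_i/q_i$ in lowest terms. Set $\gamma_0:=0/1$ (so $q_0=1$) and $\gamma_{S_Q+1}:=\gamma_1$. Then $$\sum_{i=1}^{S_Q}\frac{q_{i-1}+q_{i+1}}{q_i}=3S_Q-1.$$
   Context: For a reduced fraction $a/q\in\mathbb Q\cap(0,1]$ with $q\ge 2$, let $\bar a$ denote the multiplicative inverse of $a$ modulo $q$ in $[1,q)$, and set $h(a/q):=q+a+\bar a$; set $h(1/1):=3$. For $Q\ge3$, $\mathfrak{SF}_Q:=\{a/q\in\mathbb Q\cap(0,1]: h(a/q)\le Q\}$. -}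

module Defs where

open import Data.Nat using (ℕ; zero; suc; _+_; _*_; _≤_; _<_)
open import Data.Nat.Coprimality using (Coprime)
open import Data.Integer using (+_)
open import Data.Rational using (ℚ; 0ℚ; _/_)
import Data.Rational as ℚ
open import Data.Product using (Σ; _×_)
open import Data.Sum using (_⊎_)
open import Data.List using (List; []; _∷_; _++_; take)
open import Relation.Binary.PropositionalEquality using (_≡_)

-- n / d as a rational number (junk value 0 when d = 0; never used for d = 0 below).
frac : ℕ → ℕ → ℚ
frac n zero    = 0ℚ
frac n (suc d) = (+ n) / suc d

ReducedIn01 : ℕ → ℕ → Set
ReducedIn01 a q = 1 ≤ a × a ≤ q × Coprime a q

-- h(a/q) ≤ Q, with h(1/1) = 3 and, for q ≥ 2, h(a/q) = q + a + ā where
-- ā ∈ [1,q) is the inverse of a modulo q (unique, so we quantify over it).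
HeightLe : ℕ → ℕ → ℕ → Set
HeightLe Q a q =
  (q ≡ 1 × a ≡ 1 × 3 ≤ Q)
  ⊎ (2 ≤ q × Σ ℕ (λ b → 1 ≤ b × b < q × Σ ℕ (λ k → a * b ≡ 1 + k * q) × q + a + b ≤ Q))

InSF : ℕ → ℕ → ℕ → Set
InSF Q a q = ReducedIn01 a q × HeightLe Q a q

tripleSum : List ℕ → ℚ
tripleSum (x ∷ y ∷ z ∷ r) = frac (x + z) y ℚ.+ tripleSum (y ∷ z ∷ r)
tripleSum _               = 0ℚ

extendDenoms : List ℕ → List ℕ
extendDenoms qs = 1 ∷ qs ++ take 1 qs

-- Consecutive elements x < y of 0/1 < γ₁ < ⋯ < γ_S = 1/1 are Farey neighbours. If a·ā = 1 + kq, the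
-- Stern–Brocot parents k/ā and (a − k)/(q − ā) of a/q have smaller height, so they lie in 𝔖𝔉_Q ∪ {0/1}.
-- Neither the left parent of y nor the right parent of x lies strictly between x and y; if they are
-- not x and y respectively, then since a fraction strictly between two Farey neighbours has
-- denominator at least the sum of theirs, q_x > q_y and q_y > q_x.
-- In a chain of Farey neighbours from 0/1 to 1/1 the element of largest denominator is the mediant of
-- its two neighbours. Removing it leaves such a chain and lowers the cyclic sum Σ (q_{i-1} + q_{i+1})/q_i
-- by exactly 3, so induction down to the chain 0/1, 1/1 (sum 2) gives 3S − 1.

module Submission where

module Fractions where

  open import Defs using (frac)
  open import Data.Nat as ℕ using (ℕ; suc; _+_; _*_; _≤_)
  import Data.Nat.Properties as ℕ
  open import Data.Integer as ℤ using (+_)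
  import Data.Integer.Properties as ℤ
  open import Data.Rational as ℚ using (1ℚ; toℚᵘ)
  import Data.Rational.Properties as ℚ
  open import Data.Rational.Unnormalised as ℚᵘ using (mkℚᵘ; *≡*; *<*)
  import Data.Rational.Unnormalised.Properties as ℚᵘ
  open import Relation.Binary.PropositionalEquality

  toℚᵘ-frac : ∀ n d → toℚᵘ (frac n (suc d)) ℚᵘ.≃ mkℚᵘ (+ n) d
  toℚᵘ-frac n d = ℚ.toℚᵘ-fromℚᵘ (mkℚᵘ (+ n) d)

  frac-+ : ∀ m n d → frac m (suc d) ℚ.+ frac n (suc d) ≡ frac (m + n) (suc d)
  frac-+ m n d = ℚ.toℚᵘ-injective (let open ℚᵘ.≃-Reasoning in begin
      toℚᵘ (frac m (suc d) ℚ.+ frac n (suc d))          ≈⟨ ℚ.toℚᵘ-homo-+ (frac m (suc d)) (frac n (suc d)) ⟩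
      toℚᵘ (frac m (suc d)) ℚᵘ.+ toℚᵘ (frac n (suc d))  ≈⟨ ℚᵘ.+-cong (toℚᵘ-frac m d) (toℚᵘ-frac n d) ⟩
      mkℚᵘ (+ m) d ℚᵘ.+ mkℚᵘ (+ n) d                    ≈⟨ *≡* cross ⟩
      mkℚᵘ (+ (m + n)) d                                ≈⟨ ℚᵘ.≃-sym (toℚᵘ-frac (m + n) d) ⟩
      toℚᵘ (frac (m + n) (suc d))                       ∎)
    where
    D : ℕ
    D = suc d
    cross : (+ m ℤ.* + D ℤ.+ + n ℤ.* + D) ℤ.* + D ≡ + (m + n) ℤ.* + (D * D)
    cross = begin
      (+ m ℤ.* + D ℤ.+ + n ℤ.* + D) ℤ.* + D  ≡⟨ cong (ℤ._* + D) (cong₂ ℤ._+_ (sym (ℤ.pos-* m D)) (sym (ℤ.pos-* n D))) ⟩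
      (+ (m * D) ℤ.+ + (n * D)) ℤ.* + D      ≡⟨ cong (ℤ._* + D) (sym (ℤ.pos-+ (m * D) (n * D))) ⟩
      + (m * D + n * D) ℤ.* + D              ≡⟨ sym (ℤ.pos-* (m * D + n * D) D) ⟩
      + ((m * D + n * D) * D)                ≡⟨ cong (λ k → + (k * D)) (sym (ℕ.*-distribʳ-+ D m n)) ⟩
      + ((m + n) * D * D)                    ≡⟨ cong +_ (ℕ.*-assoc (m + n) D D) ⟩
      + ((m + n) * (D * D))                  ≡⟨ ℤ.pos-* (m + n) (D * D) ⟩
      + (m + n) ℤ.* + (D * D)                ∎
      where open ≡-Reasoning

  frac-self : ∀ {d} → 1 ≤ d → frac d d ≡ 1ℚ
  frac-self {suc d} _ = ℚ.toℚᵘ-injective (ℚᵘ.≃-trans (toℚᵘ-frac (suc d) d) (*≡* (ℤ.*-comm (+ suc d) (+ 1))))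

  frac-+-den : ∀ n {d} → 1 ≤ d → frac (n + d) d ≡ frac n d ℚ.+ 1ℚ
  frac-+-den n {suc d} 1≤d = trans (sym (frac-+ n (suc d) d)) (cong (frac n (suc d) ℚ.+_) (frac-self 1≤d))

  frac-mono-< : ∀ {a q c d} → a * suc d ℕ.< c * suc q → frac a (suc q) ℚ.< frac c (suc d)
  frac-mono-< {a} {q} {c} {d} lt = ℚ.toℚᵘ-cancel-<
    (ℚᵘ.<-respˡ-≃ (ℚᵘ.≃-sym (toℚᵘ-frac a q)) (ℚᵘ.<-respʳ-≃ (ℚᵘ.≃-sym (toℚᵘ-frac c d))
      (*<* (subst₂ ℤ._<_ (ℤ.pos-* a (suc d)) (ℤ.pos-* c (suc q)) (ℤ.+<+ lt)))))

  frac-cancel-< : ∀ {a q c d} → frac a (suc q) ℚ.< frac c (suc d) → a * suc d ℕ.< c * suc q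
  frac-cancel-< {a} {q} {c} {d} lt
    with ℚᵘ.<-respˡ-≃ (toℚᵘ-frac a q) (ℚᵘ.<-respʳ-≃ (toℚᵘ-frac c d) (ℚ.toℚᵘ-mono-< lt))
  ... | *<* cross = ℤ.drop‿+<+ (subst₂ ℤ._<_ (sym (ℤ.pos-* a (suc d))) (sym (ℤ.pos-* c (suc q))) cross)

module Lists where

  open import Data.Nat using (ℕ; _≤_)
  open import Data.Empty using (⊥)
  open import Data.List using (List; []; _∷_; _++_; length)
  open import Data.List.Extrema.Nat using (argmax; argmax-sel; f[⊥]≤f[argmax]; f[xs]≤f[argmax])
  open import Data.List.Membership.Propositional using (_∈_)
  open import Data.List.Membership.Propositional.Properties using (∈-++⁺ʳ; ∈-∃++)
  open import Data.List.Relation.Unary.All as All using (All; []; _∷_)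
  import Data.List.Relation.Unary.All.Properties as All
  open import Data.List.Relation.Unary.AllPairs as AllPairs using (AllPairs; _∷_)
  open import Data.List.Relation.Unary.Any using (here; there)
  open import Data.List.Relation.Unary.Linked as Linked using (Linked; []; [-]; _∷_)
  open import Data.Product using (∃₂; _,_)
  open import Data.Sum using (inj₁; inj₂)
  open import Relation.Binary.Core using (Rel)
  open import Relation.Binary.Definitions using (Asymmetric)
  open import Relation.Binary.PropositionalEquality

  module _ {a} {A : Set a} where

    ∷ʳ-is-∷ : ∀ (xs : List A) y → ∃₂ λ z zs → xs ++ y ∷ [] ≡ z ∷ zs
    ∷ʳ-is-∷ []       y = y , [] , refl
    ∷ʳ-is-∷ (x ∷ xs) y = x , xs ++ y ∷ [] , refl

    ∷ʳ-++-++ : ∀ pre (p : A) R E → ((pre ++ p ∷ []) ++ R) ++ E ≡ pre ++ p ∷ R ++ E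
    ∷ʳ-++-++ []        p R E = refl
    ∷ʳ-++-++ (x ∷ pre) p R E = cong (x ∷_) (∷ʳ-++-++ pre p R E)

    All-remove : ∀ {p} {P : A → Set p} pre {m post} → All P (pre ++ m ∷ post) → All P (pre ++ post)
    All-remove pre h = All.++⁺ (All.++⁻ˡ pre h) (All.tail (All.++⁻ʳ pre h))

    argmax-∈ : ∀ (f : A → ℕ) x xs → argmax f x xs ∈ x ∷ xs
    argmax-∈ f x xs with argmax-sel f x xs
    ... | inj₁ m≡x  = here m≡x
    ... | inj₂ m∈xs = there m∈xs

    linked-from-splits : ∀ {ℓ} {S : Rel A ℓ} xs →
      (∀ pre {x y} post → xs ≡ pre ++ x ∷ y ∷ post → S x y) → Linked S xs
    linked-from-splits []           _    = []
    linked-from-splits (x ∷ [])     _    = [-]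
    linked-from-splits (x ∷ y ∷ xs) S-at =
      S-at [] xs refl ∷ linked-from-splits (y ∷ xs) (λ pre post eq → S-at (x ∷ pre) post (cong (x ∷_) eq))

    module _ {ℓ} {R : Rel A ℓ} where

      linked-suffix : ∀ pre {xs} → Linked R (pre ++ xs) → Linked R xs
      linked-suffix []        l = l
      linked-suffix (_ ∷ pre) l = linked-suffix pre (Linked.tail l)

      linked-remove : ∀ pre {p m r post} → Linked R (pre ++ p ∷ m ∷ r ∷ post) → R p r →
                      Linked R (pre ++ p ∷ r ∷ post)
      linked-remove []            (_ ∷ _ ∷ l) pRr = pRr ∷ l
      linked-remove (_ ∷ [])      (h ∷ l)     pRr = h ∷ linked-remove [] l pRr
      linked-remove (_ ∷ _ ∷ pre) (h ∷ l)     pRr = h ∷ linked-remove (_ ∷ pre) l pRr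

      AllPairs-before : ∀ pre {x post} → AllPairs R (pre ++ x ∷ post) → All (λ w → R w x) pre
      AllPairs-before []        _             = []
      AllPairs-before (_ ∷ pre) (w<rest ∷ ps) = All.head (All.++⁻ʳ pre w<rest) ∷ AllPairs-before pre ps

      AllPairs-after : ∀ pre {x post} → AllPairs R (pre ++ x ∷ post) → All (R x) post
      AllPairs-after []        ps = AllPairs.head ps
      AllPairs-after (_ ∷ pre) ps = AllPairs-after pre (AllPairs.tail ps)

      nothing-between : Asymmetric R → ∀ pre {x y post z} → AllPairs R (pre ++ x ∷ y ∷ post) →
                        z ∈ pre ++ x ∷ y ∷ post → R x z → R z y → ⊥
      nothing-between asym []        _                (here refl)         xRx _   = asym xRx xRx
      nothing-between asym []        _                (there (here refl)) _   yRy = asym yRy yRy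
      nothing-between asym []        (_ ∷ y<post ∷ _) (there (there z∈))  _   zRy = asym (All.lookup y<post z∈) zRy
      nothing-between asym (_ ∷ pre) (w<rest ∷ _)     (here refl)         xRw _   =
        asym xRw (All.lookup w<rest (∈-++⁺ʳ pre (here refl)))
      nothing-between asym (_ ∷ pre) (_ ∷ ps)         (there z∈)                  = nothing-between asym pre ps z∈

  data MaxSplit {a} {A : Set a} (f : A → ℕ) : List A → Set a where
    split : ∀ pre m post → All (λ z → f z ≤ f m) (pre ++ m ∷ post) → MaxSplit f (pre ++ m ∷ post)

  max-split : ∀ {a} {A : Set a} (f : A → ℕ) xs → 1 ≤ length xs → MaxSplit f xs
  max-split f (x ∷ xs) _ with ∈-∃++ (argmax-∈ f x xs)
  ... | pre , post , eq = subst (MaxSplit f) (sym eq) (split pre (argmax f x xs) post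
          (subst (All _) eq (f[⊥]≤f[argmax] {f = f} x xs ∷ f[xs]≤f[argmax] {f = f} x xs)))

module TripleSums where

  open import Defs using (frac; tripleSum)
  open import Data.Nat using (suc; _+_; _≤_; s≤s; z≤n)
  import Data.Nat.Properties as ℕ
  open import Data.List using ([]; _∷_; _++_)
  open import Data.Product using (_,_)
  open import Data.Rational as ℚ using (ℚ; 1ℚ)
  import Data.Rational.Properties as ℚ
  open import Data.Rational.Solver using (module +-*-Solver)
  open import Relation.Binary.PropositionalEquality
  open Fractions
  open Lists
  open +-*-Solver

  shift-under-+ : ∀ t {s s′ δ} → s ≡ s′ ℚ.+ δ → t ℚ.+ s ≡ (t ℚ.+ s′) ℚ.+ δ
  shift-under-+ t {s′ = s′} {δ} eq = trans (cong (t ℚ.+_) eq) (sym (ℚ.+-assoc t s′ δ))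

  shift-under-prefix : ∀ {b B B′ δ} → (∀ y → tripleSum (y ∷ b ∷ B) ≡ tripleSum (y ∷ b ∷ B′) ℚ.+ δ) →
                       ∀ w xs → tripleSum (w ∷ xs ++ b ∷ B) ≡ tripleSum (w ∷ xs ++ b ∷ B′) ℚ.+ δ
  shift-under-prefix shift w [] = shift w
  shift-under-prefix {b} shift w (x ∷ []) = shift-under-+ (frac (w + b) x) (shift x)
  shift-under-prefix {b} {B} {B′} shift w (x ∷ x′ ∷ xs) =
    shift-under-+ (frac (w + x′) x) (shift-under-prefix {b} {B} {B′} shift x (x′ ∷ xs))

  insert-mediant : ∀ y {p r} Z w → 1 ≤ p → 1 ≤ r →
    tripleSum (y ∷ p ∷ p + r ∷ r ∷ Z ++ w ∷ []) ≡ tripleSum (y ∷ p ∷ r ∷ Z ++ w ∷ []) ℚ.+ frac 3 1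
  insert-mediant y {p} {r} Z w 1≤p 1≤r with ∷ʳ-is-∷ Z w
  ... | c , Cs , eq rewrite eq = begin
      frac (y + (p + r)) p ℚ.+ (frac (p + r) (p + r) ℚ.+ (frac (p + r + c) r ℚ.+ S))
    ≡⟨ cong₂ ℚ._+_ left (cong₂ ℚ._+_ (frac-self (ℕ.≤-trans 1≤p (ℕ.m≤m+n p r))) (cong (ℚ._+ S) right)) ⟩
      (frac (y + r) p ℚ.+ 1ℚ) ℚ.+ (1ℚ ℚ.+ ((frac (p + c) r ℚ.+ 1ℚ) ℚ.+ S))
    ≡⟨ solve 3 (λ a b s → (a :+ con 1ℚ) :+ (con 1ℚ :+ ((b :+ con 1ℚ) :+ s)) := (a :+ (b :+ s)) :+ con (frac 3 1))
             refl (frac (y + r) p) (frac (p + c) r) S ⟩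
      (frac (y + r) p ℚ.+ (frac (p + c) r ℚ.+ S)) ℚ.+ frac 3 1
    ∎
    where
    open ≡-Reasoning
    S : ℚ
    S = tripleSum (r ∷ c ∷ Cs)
    left : frac (y + (p + r)) p ≡ frac (y + r) p ℚ.+ 1ℚ
    left = trans (cong (λ n → frac n p) (trans (cong (y +_) (ℕ.+-comm p r)) (sym (ℕ.+-assoc y r p))))
                 (frac-+-den (y + r) 1≤p)
    right : frac (p + r + c) r ≡ frac (p + c) r ℚ.+ 1ℚ
    right = trans (cong (λ n → frac n r) (trans (ℕ.+-assoc p r c) (trans (cong (p +_) (ℕ.+-comm r c)) (sym (ℕ.+-assoc p c r)))))
                  (frac-+-den (p + c) 1≤r)

  -- Only 2: the leading entry is q₀ and carries no term of its own.
  insert-first-mediant : ∀ {r} Z w → 1 ≤ r →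
    tripleSum (1 ∷ suc r ∷ r ∷ Z ++ w ∷ []) ≡ tripleSum (1 ∷ r ∷ Z ++ w ∷ []) ℚ.+ frac 2 1
  insert-first-mediant {r} Z w 1≤r with ∷ʳ-is-∷ Z w
  ... | c , Cs , eq rewrite eq = begin
      frac (suc r) (suc r) ℚ.+ (frac (suc r + c) r ℚ.+ S)
    ≡⟨ cong₂ ℚ._+_ (frac-self {suc r} (s≤s z≤n)) (cong (ℚ._+ S) right) ⟩
      1ℚ ℚ.+ ((frac (suc c) r ℚ.+ 1ℚ) ℚ.+ S)
    ≡⟨ solve 2 (λ b s → con 1ℚ :+ ((b :+ con 1ℚ) :+ s) := (b :+ s) :+ con (frac 2 1)) refl (frac (suc c) r) S ⟩
      (frac (suc c) r ℚ.+ S) ℚ.+ frac 2 1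
    ∎
    where
    open ≡-Reasoning
    S : ℚ
    S = tripleSum (r ∷ c ∷ Cs)
    right : frac (suc r + c) r ≡ frac (suc c) r ℚ.+ 1ℚ
    right = trans (cong (λ n → frac (suc n) r) (ℕ.+-comm r c)) (frac-+-den (suc c) 1≤r)

module FareyNeighbours where

  open import Defs using (frac)
  open import Data.Nat using (ℕ; suc; _+_; _*_; _≤_; _<_; s≤s; z≤n)
  open import Data.Nat.Properties
  open import Data.Nat.Coprimality as Coprime using (Coprime; coprime-divisor)
  open import Data.Nat.Divisibility using (_∣_; divides; ∣1⇒≡1; ∣m+n∣m⇒∣n; ∣m⇒∣m*n; ∣n⇒∣m*n; ∣-antisym)
  open import Data.Nat.Tactic.RingSolver using (solve)
  open import Data.Empty using (⊥-elim)
  open import Data.List using ([]; _∷_)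
  open import Data.Product using (_×_; _,_; proj₁; proj₂; ∃)
  open import Data.Sum using (inj₁; inj₂)
  open import Data.Rational as ℚ using (ℚ)
  open import Function using (_on_)
  open import Relation.Binary.PropositionalEquality
  open Fractions

  Adjacent : ℕ × ℕ → ℕ × ℕ → Set
  Adjacent (a , q) (c , d) = c * q ≡ a * d + 1

  _≺_ : ℕ × ℕ → ℕ × ℕ → Set
  (a , q) ≺ (c , d) = a * d < c * q

  value : ℕ × ℕ → ℚ
  value (a , q) = frac a q

  _<ᵥ_ : ℕ × ℕ → ℕ × ℕ → Set
  _<ᵥ_ = ℚ._<_ on value

  ≺⇒<ᵥ : ∀ {x y} → 1 ≤ proj₂ x → 1 ≤ proj₂ y → x ≺ y → x <ᵥ y
  ≺⇒<ᵥ {a , suc q} {c , suc d} _ _ = frac-mono-< {a} {q} {c} {d}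

  <ᵥ⇒≺ : ∀ {x y} → 1 ≤ proj₂ x → 1 ≤ proj₂ y → x <ᵥ y → x ≺ y
  <ᵥ⇒≺ {a , suc q} {c , suc d} _ _ = frac-cancel-< {a} {q} {c} {d}

  adjacent⇒≺ : ∀ {x y} → Adjacent x y → x ≺ y
  adjacent⇒≺ {a , q} {c , d} eq = subst (a * d <_) (sym eq) (m<m+n (a * d) (s≤s z≤n))

  *≡*+1⇒coprime : ∀ {u v s t} → u * v ≡ s * t + 1 → Coprime s v
  *≡*+1⇒coprime {u} {v} {s} {t} eq {k} (k∣s , k∣v) =
    ∣1⇒≡1 (∣m+n∣m⇒∣n (subst (k ∣_) eq (∣n⇒∣m*n u k∣v)) (∣m⇒∣m*n t k∣s))

  adjacent⇒coprimeˡ : ∀ {a q y} → Adjacent (a , q) y → Coprime a q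
  adjacent⇒coprimeˡ {a} {q} {c , d} = *≡*+1⇒coprime {c} {q} {a} {d}

  adjacent⇒coprimeʳ : ∀ {x c d} → Adjacent x (c , d) → Coprime c d
  adjacent⇒coprimeʳ {a , q} {c} {d} eq = Coprime.sym (*≡*+1⇒coprime {q} {c} {d} {a}
    (trans (*-comm q c) (trans eq (cong (_+ 1) (*-comm a d)))))

  reduced-unique : ∀ {a q c d} → Coprime a q → Coprime c d → 1 ≤ d → a * d ≡ c * q → (a , q) ≡ (c , d)
  reduced-unique {a} {q} {c} {d@(suc _)} a⊥q c⊥d _ eq =
    cong₂ _,_ (*-cancelʳ-≡ a c d (trans eq (cong (c *_) q≡d))) q≡d
    where
    q≡d : q ≡ d
    q≡d = ∣-antisym (coprime-divisor (Coprime.sym a⊥q) (divides c eq))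
                    (coprime-divisor (Coprime.sym c⊥d) (divides a (sym eq)))

  den-between-adjacent : ∀ {x y z} → x ≺ y → y ≺ z → Adjacent x z → proj₂ x + proj₂ z ≤ proj₂ y
  den-between-adjacent {a , q} {b , r} {c , s} x≺y y≺z x⋈z = +-cancelˡ-≤ (q * b * s + r * a * s) (q + s) r (begin
      q * b * s + r * a * s + (q + s)    ≡⟨ solve (a ∷ b ∷ q ∷ r ∷ s ∷ []) ⟩
      s * suc (a * r) + q * suc (b * s)  ≤⟨ +-mono-≤ (*-monoʳ-≤ s x≺y) (*-monoʳ-≤ q y≺z) ⟩
      s * (b * q) + q * (c * r)          ≡⟨ solve (b ∷ c ∷ q ∷ r ∷ s ∷ []) ⟩
      q * b * s + r * (c * q)            ≡⟨ cong (λ t → q * b * s + r * t) x⋈z ⟩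
      q * b * s + r * (a * s + 1)        ≡⟨ solve (a ∷ b ∷ q ∷ r ∷ s ∷ []) ⟩
      q * b * s + r * a * s + r          ∎)
    where open ≤-Reasoning

  excess-quotient : ∀ m {A B s} → 1 ≤ s → m * A ≡ m * B + s → ∃ λ d → A ≡ B + d × s ≡ m * d
  excess-quotient m {A} {B} {s} 1≤s eq with ≤-total A B
  ... | inj₁ A≤B = ⊥-elim (<-irrefl eq (≤-<-trans (*-monoʳ-≤ m A≤B) (m<m+n (m * B) 1≤s)))
  ... | inj₂ B≤A with m≤n⇒∃[o]m+o≡n B≤A
  ...   | d , refl = d , refl , +-cancelˡ-≡ (m * B) s (m * d) (trans (sym eq) (*-distribˡ-+ m B d))

  adjacent-same-den : ∀ {a c q} → Adjacent (a , q) (c , q) → q ≡ 1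
  adjacent-same-den {a} {c} {q} eq = ∣1⇒≡1 (∣m+n∣m⇒∣n (subst (q ∣_) eq (divides c refl)) (divides a refl))

  outer-det : ∀ {p m r} → Adjacent p m → Adjacent m r →
    proj₂ m * (proj₁ r * proj₂ p) ≡ proj₂ m * (proj₁ p * proj₂ r) + (proj₂ p + proj₂ r)
  outer-det {a , q} {b , n} {c , s} p⋈m m⋈r = begin
      n * (c * q)            ≡⟨ solve (c ∷ n ∷ q ∷ []) ⟩
      q * (c * n)            ≡⟨ cong (q *_) m⋈r ⟩
      q * (b * s + 1)        ≡⟨ solve (b ∷ q ∷ s ∷ []) ⟩
      s * (b * q) + q        ≡⟨ cong (λ t → s * t + q) p⋈m ⟩
      s * (a * n + 1) + q    ≡⟨ solve (a ∷ n ∷ q ∷ s ∷ []) ⟩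
      n * (a * s) + (q + s)  ∎
    where open ≡-Reasoning

  max-den-is-mediant : ∀ {p m r} → Adjacent p m → Adjacent m r →
                       1 ≤ proj₂ p → proj₂ p ≤ proj₂ m → proj₂ r ≤ proj₂ m → 2 ≤ proj₂ m →
                       proj₂ m ≡ proj₂ p + proj₂ r × Adjacent p r
  max-den-is-mediant {a , q} {b , n} {c , s} p⋈m m⋈r 1≤q q≤n s≤n 2≤n
    with excess-quotient n (≤-trans 1≤q (m≤m+n q s)) (outer-det {a , q} {b , n} {c , s} p⋈m m⋈r)
  ... | 0           , _    , q+s≡0 = ⊥-elim (<-irrefl (sym (trans q+s≡0 (*-zeroʳ n))) (≤-trans 1≤q (m≤m+n q s)))
  ... | 1           , c*q≡ , q+s≡n = sym (trans q+s≡n (*-identityʳ n)) , c*q≡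
  ... | suc (suc d) , _    , q+s≡  =
    ⊥-elim (<-irrefl (sym (adjacent-same-den {a} {b} {n} (subst (λ t → b * t ≡ a * n + 1) q≡n p⋈m))) 2≤n)
    where
    q≡n : q ≡ n
    q≡n = ≤-antisym q≤n (+-cancelʳ-≤ n n q (begin
      n + n            ≤⟨ +-monoʳ-≤ n (m≤m*n n (suc d)) ⟩
      n + n * suc d    ≡⟨ sym (*-suc n (suc d)) ⟩
      n * suc (suc d)  ≡⟨ sym q+s≡ ⟩
      q + s            ≤⟨ +-monoʳ-≤ q s≤n ⟩
      q + n            ∎))
      where open ≤-Reasoning

module SternBrocotParents where

  open import Defs using (InSF)
  open import Data.Nat as ℕ using (ℕ; zero; suc; _+_; _*_; _≤_; _<_; s≤s; z≤n; _%_; _/_)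
  open import Data.Nat.Properties
  open import Data.Nat.DivMod using (%-distribˡ-*; m%n%n≡m%n; [m+kn]%n≡m%n; m≡m%n+[m/n]*n; m%n<n; m%n≤m)
  open import Data.Nat.Coprimality as Coprime using (Coprime)
  open import Data.Nat.Tactic.RingSolver using (solve)
  open import Data.List using ([]; _∷_)
  open import Data.Product using (_×_; _,_; proj₁; proj₂; ∃; Σ)
  open import Data.Sum using (_⊎_; inj₁; inj₂)
  open import Relation.Binary.PropositionalEquality
  open FareyNeighbours

  InSF₀ : ℕ → ℕ × ℕ → Set
  InSF₀ Q x = x ≡ (0 , 1) ⊎ InSF Q (proj₁ x) (proj₂ x)

  InSF₀⇒1≤den : ∀ {Q x} → InSF₀ Q x → 1 ≤ proj₂ x
  InSF₀⇒1≤den (inj₁ refl)                  = s≤s z≤n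
  InSF₀⇒1≤den (inj₂ ((1≤a , a≤q , _) , _)) = ≤-trans 1≤a a≤q

  InSF₀⇒coprime : ∀ {Q x} → InSF₀ Q x → Coprime (proj₁ x) (proj₂ x)
  InSF₀⇒coprime (inj₁ refl)                = Coprime.sym (Coprime.1-coprimeTo 0)
  InSF₀⇒coprime (inj₂ ((_ , _ , a⊥q) , _)) = a⊥q

  quotient-< : ∀ {m} k w t → m ≡ 1 + k * w → m ≤ t * w → k < t
  quotient-< k w t eq m≤tw = *-cancelʳ-< w k t (≤-trans (≤-reflexive (sym eq)) m≤tw)

  inverse-mod : ∀ c x {n} → 2 ≤ n → (∃ λ y → c * x ≡ 1 + y * n) →
                Σ ℕ λ b → 1 ≤ b × b < n × b ≤ x × ∃ λ k → c * b ≡ 1 + k * n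
  inverse-mod c x {1} (s≤s ()) _
  inverse-mod c x {n@(suc (suc _))} _ (y , eq) =
    x % n , 1≤b , m%n<n x n , m%n≤m x n , c * (x % n) / n ,
    trans (m≡m%n+[m/n]*n (c * (x % n)) n) (cong (_+ c * (x % n) / n * n) cb%n≡1)
    where
    cb%n≡1 : c * (x % n) % n ≡ 1
    cb%n≡1 = begin
      c * (x % n) % n          ≡⟨ %-distribˡ-* c (x % n) n ⟩
      c % n * (x % n % n) % n  ≡⟨ cong (λ t → c % n * t % n) (m%n%n≡m%n x n) ⟩
      c % n * (x % n) % n      ≡⟨ sym (%-distribˡ-* c x n) ⟩
      c * x % n                ≡⟨ cong (_% n) eq ⟩
      (1 + y * n) % n          ≡⟨ [m+kn]%n≡m%n 1 y n ⟩
      1                        ∎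
      where open ≡-Reasoning
    1≤b : 1 ≤ x % n
    1≤b = n≢0⇒n>0 (λ b≡0 → 0≢1+n (trans (sym (cong (_% n) (*-zeroʳ c)))
                                         (trans (cong (λ t → c * t % n) (sym b≡0)) cb%n≡1)))

  InSF-intro : ∀ {Q c n} x → 3 ≤ Q → 1 ≤ c → c ≤ n → Coprime c n → (∃ λ y → c * x ≡ 1 + y * n) →
               (∀ {b} → b < n → b ≤ x → n + c + b ≤ Q) → InSF Q c n
  InSF-intro {n = 1} _ 3≤Q (s≤s z≤n) (s≤s z≤n) c⊥n _ _ = (s≤s z≤n , s≤s z≤n , c⊥n) , inj₁ (refl , refl , 3≤Q)
  InSF-intro {c = c} {n@(suc (suc _))} x _ 1≤c c≤n c⊥n inv height with inverse-mod c x (s≤s (s≤s z≤n)) inv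
  ... | b , 1≤b , b<n , b≤x , k , cb≡ =
    (1≤c , c≤n , c⊥n) , inj₂ (s≤s (s≤s z≤n) , b , 1≤b , b<n , (k , cb≡) , height b<n b≤x)

  3≤height : ∀ {Q a q b} → 2 ≤ q → 1 ≤ a → q + a + b ≤ Q → 3 ≤ Q
  3≤height {a = a} {q} {b} 2≤q 1≤a h≤Q = ≤-trans (≤-trans (+-mono-≤ 2≤q 1≤a) (m≤m+n (q + a) b)) h≤Q

  -- kq ≡ −1 (mod b) for b = 1 + b₁, so b₁q inverts k modulo b.
  quotient-inverse : ∀ {a b₁} k q → 1 ≤ a → 1 ≤ b₁ → a * suc b₁ ≡ 1 + k * q →
                     ∃ λ y → k * (b₁ * q) ≡ 1 + y * suc b₁
  quotient-inverse {suc a₁} {suc b₂} k q _ _ eq = b₂ + a₁ * suc b₂ , +-cancelʳ-≡ (suc b₂) _ _ (begin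
      k * (suc b₂ * q) + suc b₂                       ≡⟨ solve (k ∷ b₂ ∷ q ∷ []) ⟩
      suc b₂ * (1 + k * q)                            ≡⟨ cong (suc b₂ *_) (sym eq) ⟩
      suc b₂ * (suc a₁ * suc (suc b₂))                ≡⟨ solve (a₁ ∷ b₂ ∷ []) ⟩
      1 + (b₂ + a₁ * suc b₂) * suc (suc b₂) + suc b₂  ∎)
    where open ≡-Reasoning

  left-parent : ∀ {Q a q} → InSF Q a q → ∃ λ p → InSF₀ Q p × Adjacent p (a , q)
  left-parent (_ , inj₁ (refl , refl , _)) = (0 , 1) , inj₁ refl , refl
  left-parent {a = a} (_ , inj₂ (_ , b , _ , _ , (zero , ab≡1) , _)) =
    (0 , b) , inj₁ (cong (0 ,_) (m*n≡1⇒n≡1 a b ab≡1)) , ab≡1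
  left-parent {Q} {a} {q} ((1≤a , a≤q , _) , inj₂ (2≤q , b@(suc b₁) , _ , b<q , (k@(suc _) , ab≡) , h≤Q)) =
    (k , b) , inj₂ k/b∈SF , k/b⋈a/q
    where
    k/b⋈a/q : Adjacent (k , b) (a , q)
    k/b⋈a/q = trans ab≡ (+-comm 1 (k * q))
    k<b : k < b
    k<b = quotient-< k q b ab≡ (≤-trans (*-monoˡ-≤ b a≤q) (≤-reflexive (*-comm q b)))
    k≤a : k ≤ a
    k≤a = <⇒≤ (quotient-< k q a ab≡ (*-monoʳ-≤ a (<⇒≤ b<q)))
    height : ∀ {b′} → b′ < b → b′ ≤ b₁ * q → b + k + b′ ≤ Q
    height {b′} b′<b _ = begin
      b + k + b′  ≤⟨ +-mono-≤ (+-monoʳ-≤ b k≤a) (<⇒≤ (<-trans b′<b b<q)) ⟩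
      b + a + q   ≡⟨ solve (a ∷ b₁ ∷ q ∷ []) ⟩
      q + a + b   ≤⟨ h≤Q ⟩
      Q           ∎
      where open ≤-Reasoning
    k/b∈SF : InSF Q k b
    k/b∈SF = InSF-intro (b₁ * q) (3≤height 2≤q 1≤a h≤Q) (s≤s z≤n) (<⇒≤ k<b) (adjacent⇒coprimeˡ {y = a , q} k/b⋈a/q)
               (quotient-inverse k q 1≤a (≤-pred (≤-trans (s≤s (s≤s z≤n)) k<b)) ab≡) height

  complement-inverse : ∀ k c b n → (k + c) * b ≡ 1 + k * (b + n) → c * b ≡ 1 + k * n
  complement-inverse k c b n eq = +-cancelˡ-≡ (k * b) (c * b) (1 + k * n) (begin
      k * b + c * b        ≡⟨ solve (k ∷ c ∷ b ∷ []) ⟩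
      (k + c) * b          ≡⟨ eq ⟩
      1 + k * (b + n)      ≡⟨ solve (k ∷ b ∷ n ∷ []) ⟩
      k * b + (1 + k * n)  ∎)
    where open ≡-Reasoning

  complement-adjacent : ∀ k c b n → c * b ≡ 1 + k * n → Adjacent (k + c , b + n) (c , n)
  complement-adjacent k c b n eq = begin
      c * (b + n)        ≡⟨ solve (c ∷ b ∷ n ∷ []) ⟩
      c * b + c * n      ≡⟨ cong (_+ c * n) eq ⟩
      1 + k * n + c * n  ≡⟨ solve (k ∷ c ∷ n ∷ []) ⟩
      (k + c) * n + 1    ∎
    where open ≡-Reasoning

  complement-≤ : ∀ k c b n → 1 ≤ n → k < b → c * b ≡ 1 + k * n → c ≤ n
  complement-≤ k c b n 1≤n k<b eq = *-cancelʳ-≤ c n b {{ℕ.>-nonZero (≤-trans (s≤s z≤n) k<b)}} (begin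
      c * b      ≡⟨ eq ⟩
      1 + k * n  ≤⟨ +-monoˡ-≤ (k * n) 1≤n ⟩
      suc k * n  ≤⟨ *-monoˡ-≤ n k<b ⟩
      b * n      ≡⟨ *-comm b n ⟩
      n * b      ∎)
    where open ≤-Reasoning

  right-parent : ∀ {Q a q} → InSF Q a q → 2 ≤ q → ∃ λ r → InSF Q (proj₁ r) (proj₂ r) × Adjacent (a , q) r
  right-parent (_ , inj₁ (refl , refl , _)) (s≤s ())
  right-parent {Q} {a} {q} ((1≤a , a≤q , _) , inj₂ (2≤q , b , _ , b<q , (k , ab≡) , h≤Q)) _
    with m≤n⇒∃[o]m+o≡n (<⇒≤ (quotient-< k q a ab≡ (*-monoʳ-≤ a (<⇒≤ b<q)))) | m≤n⇒∃[o]m+o≡n (<⇒≤ b<q)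
  ... | c , refl | n , refl = (c , n) , c/n∈SF , complement-adjacent k c b n cb≡
    where
    cb≡ : c * b ≡ 1 + k * n
    cb≡ = complement-inverse k c b n ab≡
    1≤c : 1 ≤ c
    1≤c = +-cancelˡ-< k 0 c (subst (_< k + c) (sym (+-identityʳ k))
            (quotient-< k (b + n) (k + c) ab≡ (*-monoʳ-≤ (k + c) (<⇒≤ b<q))))
    1≤n : 1 ≤ n
    1≤n = +-cancelˡ-< b 0 n (subst (_< b + n) (sym (+-identityʳ b)) b<q)
    k<b : k < b
    k<b = quotient-< k (b + n) b ab≡ (≤-trans (*-monoˡ-≤ b a≤q) (≤-reflexive (*-comm (b + n) b)))
    height : ∀ {b′} → b′ < n → b′ ≤ b → n + c + b′ ≤ Q
    height {b′} _ b′≤b = begin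
      n + c + b′           ≤⟨ +-monoʳ-≤ (n + c) b′≤b ⟩
      n + c + b            ≤⟨ m≤m+n (n + c + b) (b + k) ⟩
      n + c + b + (b + k)  ≡⟨ solve (k ∷ c ∷ b ∷ n ∷ []) ⟩
      b + n + (k + c) + b  ≤⟨ h≤Q ⟩
      Q                    ∎
      where open ≤-Reasoning
    c/n∈SF : InSF Q c n
    c/n∈SF = InSF-intro b (3≤height 2≤q 1≤a h≤Q) 1≤c (complement-≤ k c b n 1≤n k<b cb≡)
               (adjacent⇒coprimeʳ {x = k + c , b + n} (complement-adjacent k c b n cb≡)) (k , cb≡) height

module FareyChains where

  open import Defs using (frac; tripleSum; extendDenoms)
  open import Data.Nat using (ℕ; zero; suc; _+_; _*_; _∸_; _≤_; s≤s; z≤n)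
  open import Data.Nat.Properties using (≤-trans; suc-injective; +-comm)
  import Data.Nat.Tactic.RingSolver as ℕ
  open import Data.List using (List; []; _∷_; _++_; map; length; take; initLast; _∷ʳ′_)
  open import Data.List.Properties using (length-++-sucʳ; length-++)
  open import Data.List.Relation.Unary.All as All using (All; []; _∷_)
  import Data.List.Relation.Unary.All.Properties as All
  open import Data.List.Relation.Unary.Linked as Linked using (Linked; _∷_)
  open import Data.Product using (_×_; _,_; proj₁; proj₂)
  open import Data.Rational as ℚ using (ℚ; 0ℚ)
  import Data.Rational.Properties as ℚ
  open import Algebra.Properties.Group ℚ.+-0-group using (∙-cancelʳ)
  open import Data.Rational.Solver using (module +-*-Solver)
  open import Relation.Binary.PropositionalEquality
  open Fractions
  open Lists
  open TripleSums
  open FareyNeighbours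
  open +-*-Solver

  record Chain (xs : List (ℕ × ℕ)) : Set where
    field
      adjacent : Linked Adjacent ((0 , 1) ∷ xs ++ (1 , 1) ∷ [])
      interior : All (λ x → 2 ≤ proj₂ x) xs
  open Chain

  firstDen : List (ℕ × ℕ) → ℕ
  firstDen []      = 1
  firstDen (x ∷ _) = proj₂ x

  -- The theorem's sum is chainWeight q₁ xs − q₁, w playing q_{S+1} = q₁. Keeping w free and adding q₁
  -- instead makes removing x₁ a change near the front of the sequence only.
  chainWeight : ℕ → List (ℕ × ℕ) → ℚ
  chainWeight w xs = tripleSum (1 ∷ map proj₂ (xs ++ (1 , 1) ∷ []) ++ w ∷ []) ℚ.+ frac (firstDen xs) 1

  firstDen-∷ʳ : ∀ post {r B} → post ++ (1 , 1) ∷ [] ≡ r ∷ B → firstDen post ≡ proj₂ r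
  firstDen-∷ʳ []      refl = refl
  firstDen-∷ʳ (_ ∷ _) refl = refl

  firstDen-++ : ∀ pre p R R′ → firstDen ((pre ++ p ∷ []) ++ R) ≡ firstDen ((pre ++ p ∷ []) ++ R′)
  firstDen-++ []      _ _ _ = refl
  firstDen-++ (_ ∷ _) _ _ _ = refl

  map-∷ʳ-++ : ∀ pre p R w → map proj₂ (((pre ++ p ∷ []) ++ R) ++ (1 , 1) ∷ []) ++ w ∷ [] ≡
                            map proj₂ pre ++ proj₂ p ∷ map proj₂ (R ++ (1 , 1) ∷ []) ++ w ∷ []
  map-∷ʳ-++ []        p R w = refl
  map-∷ʳ-++ (x ∷ pre) p R w = cong (proj₂ x ∷_) (map-∷ʳ-++ pre p R w)

  next-den-bounds : ∀ {m : ℕ × ℕ} post {r B} → post ++ (1 , 1) ∷ [] ≡ r ∷ B → 2 ≤ proj₂ m →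
    All (λ z → 2 ≤ proj₂ z) post → All (λ z → proj₂ z ≤ proj₂ m) post → 1 ≤ proj₂ r × proj₂ r ≤ proj₂ m
  next-den-bounds {m} post eq 2≤m 2≤post post≤m = All.head (subst (All Bounded) eq bounds)
    where
    Bounded : ℕ × ℕ → Set
    Bounded z = 1 ≤ proj₂ z × proj₂ z ≤ proj₂ m
    bounds : All Bounded (post ++ (1 , 1) ∷ [])
    bounds = All.++⁺ (All.zipWith (λ (2≤z , z≤m) → ≤-trans (s≤s z≤n) 2≤z , z≤m) (2≤post , post≤m))
                     ((s≤s z≤n , ≤-trans (s≤s z≤n) 2≤m) ∷ [])

  chainWeight-remove-first : ∀ m post {r B} w → post ++ (1 , 1) ∷ [] ≡ r ∷ B →
    proj₂ m ≡ 1 + proj₂ r → 1 ≤ proj₂ r → chainWeight w (m ∷ post) ≡ chainWeight w post ℚ.+ frac 3 1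
  chainWeight-remove-first m post {r} {B} w eq m≡1+r 1≤r = begin
      tripleSum (1 ∷ proj₂ m ∷ map proj₂ (post ++ (1 , 1) ∷ []) ++ w ∷ []) ℚ.+ frac (proj₂ m) 1
    ≡⟨ cong₂ (λ T d → tripleSum (1 ∷ d ∷ map proj₂ T ++ w ∷ []) ℚ.+ frac d 1) eq m≡1+r ⟩
      tripleSum (1 ∷ suc qr ∷ qr ∷ Z ++ w ∷ []) ℚ.+ frac (suc qr) 1
    ≡⟨ cong₂ ℚ._+_ (insert-first-mediant Z w 1≤r) (sym (frac-+ 1 qr 0)) ⟩
      (tripleSum (1 ∷ qr ∷ Z ++ w ∷ []) ℚ.+ frac 2 1) ℚ.+ (frac 1 1 ℚ.+ frac qr 1)
    ≡⟨ solve 2 (λ t f → (t :+ con (frac 2 1)) :+ (con (frac 1 1) :+ f) := (t :+ f) :+ con (frac 3 1))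
             refl (tripleSum (1 ∷ qr ∷ Z ++ w ∷ [])) (frac qr 1) ⟩
      (tripleSum (1 ∷ qr ∷ Z ++ w ∷ []) ℚ.+ frac qr 1) ℚ.+ frac 3 1
    ≡⟨ cong₂ (λ T d → (tripleSum (1 ∷ map proj₂ T ++ w ∷ []) ℚ.+ frac d 1) ℚ.+ frac 3 1)
             (sym eq) (sym (firstDen-∷ʳ post eq)) ⟩
      chainWeight w post ℚ.+ frac 3 1
    ∎
    where
    open ≡-Reasoning
    qr : ℕ
    qr = proj₂ r
    Z : List ℕ
    Z = map proj₂ B

  chainWeight-remove-mediant : ∀ pre p m post {r B} w → post ++ (1 , 1) ∷ [] ≡ r ∷ B →
    proj₂ m ≡ proj₂ p + proj₂ r → 1 ≤ proj₂ p → 1 ≤ proj₂ r →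
    chainWeight w ((pre ++ p ∷ []) ++ m ∷ post) ≡ chainWeight w ((pre ++ p ∷ []) ++ post) ℚ.+ frac 3 1
  chainWeight-remove-mediant pre p m post {r} {B} w eq m≡p+r 1≤p 1≤r = begin
      tripleSum (1 ∷ map proj₂ (((pre ++ p ∷ []) ++ m ∷ post) ++ (1 , 1) ∷ []) ++ w ∷ []) ℚ.+ f
    ≡⟨ cong (λ T → tripleSum (1 ∷ T) ℚ.+ f) (map-∷ʳ-++ pre p (m ∷ post) w) ⟩
      tripleSum (1 ∷ Y ++ qp ∷ proj₂ m ∷ map proj₂ (post ++ (1 , 1) ∷ []) ++ w ∷ []) ℚ.+ f
    ≡⟨ cong₂ (λ T d → tripleSum (1 ∷ Y ++ qp ∷ d ∷ map proj₂ T ++ w ∷ []) ℚ.+ f) eq m≡p+r ⟩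
      tripleSum (1 ∷ Y ++ qp ∷ qp + qr ∷ qr ∷ Z ++ w ∷ []) ℚ.+ f
    ≡⟨ cong (ℚ._+ f) (shift-under-prefix (λ y → insert-mediant y Z w 1≤p 1≤r) 1 Y) ⟩
      (tripleSum (1 ∷ Y ++ qp ∷ qr ∷ Z ++ w ∷ []) ℚ.+ frac 3 1) ℚ.+ f
    ≡⟨ solve 2 (λ t f → (t :+ con (frac 3 1)) :+ f := (t :+ f) :+ con (frac 3 1))
             refl (tripleSum (1 ∷ Y ++ qp ∷ qr ∷ Z ++ w ∷ [])) f ⟩
      (tripleSum (1 ∷ Y ++ qp ∷ qr ∷ Z ++ w ∷ []) ℚ.+ f) ℚ.+ frac 3 1
    ≡⟨ cong₂ (λ T d → (tripleSum (1 ∷ Y ++ qp ∷ map proj₂ T ++ w ∷ []) ℚ.+ frac d 1) ℚ.+ frac 3 1)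
             (sym eq) (firstDen-++ pre p (m ∷ post) post) ⟩
      (tripleSum (1 ∷ Y ++ qp ∷ map proj₂ (post ++ (1 , 1) ∷ []) ++ w ∷ []) ℚ.+ frac (firstDen ((pre ++ p ∷ []) ++ post)) 1)
        ℚ.+ frac 3 1
    ≡⟨ cong (λ T → (tripleSum (1 ∷ T) ℚ.+ _) ℚ.+ frac 3 1) (sym (map-∷ʳ-++ pre p post w)) ⟩
      chainWeight w ((pre ++ p ∷ []) ++ post) ℚ.+ frac 3 1
    ∎
    where
    open ≡-Reasoning
    f : ℚ
    f = frac (firstDen ((pre ++ p ∷ []) ++ m ∷ post)) 1
    Y Z : List ℕ
    Y = map proj₂ pre
    Z = map proj₂ B
    qp qr : ℕ
    qp = proj₂ p
    qr = proj₂ r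

  remove-first : ∀ m post → Chain (m ∷ post) → All (λ z → proj₂ z ≤ proj₂ m) post →
    Chain post × (∀ w → chainWeight w (m ∷ post) ≡ chainWeight w post ℚ.+ frac 3 1)
  remove-first m post c post≤m with ∷ʳ-is-∷ post (1 , 1)
  ... | r , B , eq = shorter , λ w → chainWeight-remove-first m post w eq (proj₁ m-mediant) (proj₁ r-bounds)
    where
    chain : Linked Adjacent ((0 , 1) ∷ m ∷ r ∷ B)
    chain = subst (λ T → Linked Adjacent ((0 , 1) ∷ m ∷ T)) eq (adjacent c)
    2≤m : 2 ≤ proj₂ m
    2≤m = All.head (interior c)
    r-bounds : 1 ≤ proj₂ r × proj₂ r ≤ proj₂ m
    r-bounds = next-den-bounds {m} post eq 2≤m (All.tail (interior c)) post≤m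
    m-mediant : proj₂ m ≡ 1 + proj₂ r × Adjacent (0 , 1) r
    m-mediant = max-den-is-mediant {0 , 1} {m} {r} (Linked.head chain) (Linked.head (Linked.tail chain))
                                   (s≤s z≤n) (≤-trans (s≤s z≤n) 2≤m) (proj₂ r-bounds) 2≤m
    shorter : Chain post
    shorter = record
      { adjacent = subst (λ T → Linked Adjacent ((0 , 1) ∷ T)) (sym eq) (proj₂ m-mediant ∷ Linked.tail (Linked.tail chain))
      ; interior = All.tail (interior c) }

  remove-interior : ∀ pre p m post → Chain ((pre ++ p ∷ []) ++ m ∷ post) →
    All (λ z → proj₂ z ≤ proj₂ m) ((pre ++ p ∷ []) ++ m ∷ post) →
    Chain ((pre ++ p ∷ []) ++ post) ×
    (∀ w → chainWeight w ((pre ++ p ∷ []) ++ m ∷ post) ≡ chainWeight w ((pre ++ p ∷ []) ++ post) ℚ.+ frac 3 1)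
  remove-interior pre p m post c max with ∷ʳ-is-∷ post (1 , 1)
  ... | r , B , eq = shorter , λ w → chainWeight-remove-mediant pre p m post w eq (proj₁ m-mediant) 1≤p (proj₁ r-bounds)
    where
    split-at : ∀ R {T} → R ++ (1 , 1) ∷ [] ≡ T →
               (0 , 1) ∷ ((pre ++ p ∷ []) ++ R) ++ (1 , 1) ∷ [] ≡ ((0 , 1) ∷ pre) ++ p ∷ T
    split-at R eqR = cong ((0 , 1) ∷_) (trans (∷ʳ-++-++ pre p R ((1 , 1) ∷ [])) (cong (λ T → pre ++ p ∷ T) eqR))
    chain : Linked Adjacent (((0 , 1) ∷ pre) ++ p ∷ m ∷ r ∷ B)
    chain = subst (Linked Adjacent) (split-at (m ∷ post) (cong (m ∷_) eq)) (adjacent c)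
    from-m : All (λ z → 2 ≤ proj₂ z) (m ∷ post)
    from-m = All.++⁻ʳ (pre ++ p ∷ []) (interior c)
    2≤m : 2 ≤ proj₂ m
    2≤m = All.head from-m
    1≤p : 1 ≤ proj₂ p
    1≤p = ≤-trans (s≤s z≤n) (All.head (All.++⁻ʳ pre (All.++⁻ˡ (pre ++ p ∷ []) (interior c))))
    p≤m : proj₂ p ≤ proj₂ m
    p≤m = All.head (All.++⁻ʳ pre (All.++⁻ˡ (pre ++ p ∷ []) max))
    r-bounds : 1 ≤ proj₂ r × proj₂ r ≤ proj₂ m
    r-bounds = next-den-bounds {m} post eq 2≤m (All.tail from-m) (All.tail (All.++⁻ʳ (pre ++ p ∷ []) max))
    m-mediant : proj₂ m ≡ proj₂ p + proj₂ r × Adjacent p r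
    m-mediant with linked-suffix ((0 , 1) ∷ pre) chain
    ... | p⋈m ∷ m⋈r ∷ _ = max-den-is-mediant {p} {m} {r} p⋈m m⋈r 1≤p p≤m (proj₂ r-bounds) 2≤m
    shorter : Chain ((pre ++ p ∷ []) ++ post)
    shorter = record
      { adjacent = subst (Linked Adjacent) (sym (split-at post eq)) (linked-remove ((0 , 1) ∷ pre) chain (proj₂ m-mediant))
      ; interior = All-remove (pre ++ p ∷ []) (interior c) }

  remove-max : ∀ pre m post → Chain (pre ++ m ∷ post) → All (λ z → proj₂ z ≤ proj₂ m) (pre ++ m ∷ post) →
    Chain (pre ++ post) × (∀ w → chainWeight w (pre ++ m ∷ post) ≡ chainWeight w (pre ++ post) ℚ.+ frac 3 1)
  remove-max pre m post c max with initLast pre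
  ... | []         = remove-first m post c (All.tail max)
  ... | pre′ ∷ʳ′ p = remove-interior pre′ p m post c max

  chain-weight : ∀ n xs → length xs ≡ n → Chain xs → ∀ w → chainWeight w xs ≡ frac (2 + 3 * n) 1 ℚ.+ frac w 1
  chain-weight zero [] _ _ w = begin
      (frac (1 + w) 1 ℚ.+ 0ℚ) ℚ.+ frac 1 1           ≡⟨ cong (λ t → (t ℚ.+ 0ℚ) ℚ.+ frac 1 1) (sym (frac-+ 1 w 0)) ⟩
      ((frac 1 1 ℚ.+ frac w 1) ℚ.+ 0ℚ) ℚ.+ frac 1 1  ≡⟨ solve 1 (λ v → ((con (frac 1 1) :+ v) :+ con 0ℚ) :+ con (frac 1 1)
                                                                   := con (frac 2 1) :+ v) refl (frac w 1) ⟩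
      frac 2 1 ℚ.+ frac w 1                           ∎
    where open ≡-Reasoning
  chain-weight zero (_ ∷ _) () _ _
  chain-weight (suc n) xs len c w with max-split proj₂ xs (subst (1 ≤_) (sym len) (s≤s z≤n))
  ... | split pre m post max with remove-max pre m post c max
  ...   | shorter , removal = begin
      chainWeight w (pre ++ m ∷ post)                 ≡⟨ removal w ⟩
      chainWeight w (pre ++ post) ℚ.+ frac 3 1        ≡⟨ cong (ℚ._+ frac 3 1) (chain-weight n (pre ++ post) len′ shorter w) ⟩
      (frac (2 + 3 * n) 1 ℚ.+ frac w 1) ℚ.+ frac 3 1  ≡⟨ solve 3 (λ k v t → (k :+ v) :+ t := (k :+ t) :+ v)
                                                                 refl (frac (2 + 3 * n) 1) (frac w 1) (frac 3 1) ⟩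
      (frac (2 + 3 * n) 1 ℚ.+ frac 3 1) ℚ.+ frac w 1  ≡⟨ cong (ℚ._+ frac w 1) (trans (frac-+ (2 + 3 * n) 3 0)
                                                                                     (cong (λ k → frac k 1) (count n))) ⟩
      frac (2 + 3 * suc n) 1 ℚ.+ frac w 1             ∎
    where
    open ≡-Reasoning
    len′ : length (pre ++ post) ≡ n
    len′ = suc-injective (trans (sym (length-++-sucʳ pre m post)) len)
    count : ∀ n → 2 + 3 * n + 3 ≡ 2 + 3 * suc n
    count = ℕ.solve-∀

  chain-sum : ∀ xs → Chain xs →
    tripleSum (extendDenoms (map proj₂ (xs ++ (1 , 1) ∷ []))) ≡ frac (3 * length (xs ++ (1 , 1) ∷ []) ∸ 1) 1
  chain-sum xs c = begin
      tripleSum (1 ∷ D ++ take 1 D)   ≡⟨ cong (λ t → tripleSum (1 ∷ D ++ t)) (take-first xs) ⟩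
      tripleSum (1 ∷ D ++ f ∷ [])     ≡⟨ ∙-cancelʳ (frac f 1) _ _ (chain-weight (length xs) xs refl c f) ⟩
      frac (2 + 3 * length xs) 1      ≡⟨ cong (λ k → frac k 1) (trans (count (length xs)) (cong (λ k → 3 * k ∸ 1) (sym len))) ⟩
      frac (3 * length (xs ++ (1 , 1) ∷ []) ∸ 1) 1 ∎
    where
    open ≡-Reasoning
    D : List ℕ
    D = map proj₂ (xs ++ (1 , 1) ∷ [])
    f : ℕ
    f = firstDen xs
    take-first : ∀ xs → take 1 (map proj₂ (xs ++ (1 , 1) ∷ [])) ≡ firstDen xs ∷ []
    take-first []      = refl
    take-first (_ ∷ _) = refl
    len : length (xs ++ (1 , 1) ∷ []) ≡ suc (length xs)
    len = trans (length-++ xs) (+-comm (length xs) 1)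
    -- The right-hand side is what 3 * suc n ∸ 1 reduces to.
    count : ∀ n → 2 + 3 * n ≡ n + 2 * suc n
    count = ℕ.solve-∀

module SortedSF where

  open import Defs using (InSF)
  open import Data.Nat using (ℕ; _*_; _≤_; _<_; s≤s; z≤n)
  open import Data.Nat.Properties
    using (≤-trans; *-identityʳ; +-identityʳ; ≤-reflexive; <⇒≱; <-cmp; <-asym; <-≤-trans; m<n+m; m<m+n; n≮0)
  import Data.Nat.Coprimality as Coprime
  open import Data.Empty using (⊥; ⊥-elim)
  open import Data.List using (List; []; _∷_; _++_; map)
  open import Data.List.Membership.Propositional using (_∈_)
  open import Data.List.Membership.Propositional.Properties using (∈-++⁺ʳ; ∈-∃++)
  open import Data.List.Relation.Unary.All as All using (All; []; _∷_)
  import Data.List.Relation.Unary.All.Properties as All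
  open import Data.List.Relation.Unary.AllPairs as AllPairs using (AllPairs)
  open import Data.List.Relation.Unary.Any using (here; there)
  open import Data.List.Relation.Unary.Linked using (Linked; [-]; _∷_)
  import Data.List.Relation.Unary.Linked.Properties as Linked
  open import Data.Product using (_×_; _,_; proj₁; proj₂; ∃)
  open import Data.Sum using (inj₁; inj₂)
  import Data.Rational as ℚ
  import Data.Rational.Properties as ℚ
  open import Function.Bundles using (_⇔_; mk⇔; module Equivalence)
  open import Relation.Binary.Definitions using (tri<; tri≈; tri>)
  open import Relation.Binary.PropositionalEquality
  open Lists
  open FareyNeighbours
  open SternBrocotParents
  open FareyChains using (Chain)

  adjacent-if-nothing-between : ∀ {Q x y} → InSF₀ Q x → InSF₀ Q y → x ≺ y →
    (∀ z → InSF₀ Q z → x ≺ z → z ≺ y → ⊥) → Adjacent x y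
  adjacent-if-nothing-between _ (inj₁ refl) x≺0 _ = ⊥-elim (n≮0 x≺0)
  adjacent-if-nothing-between {Q} {x@(a , q)} {y@(c , d)} x∈ (inj₂ y∈) x≺y nothing-between
    with left-parent y∈
  ... | p , p∈ , p⋈y with <-cmp (proj₁ p * q) (a * proj₂ p)
  ...   | tri≈ _ p≈x _ = subst (λ z → Adjacent z y)
            (reduced-unique {proj₁ p} {proj₂ p} (adjacent⇒coprimeˡ {y = y} p⋈y) (InSF₀⇒coprime x∈) (InSF₀⇒1≤den x∈) p≈x)
            p⋈y
  ...   | tri> _ _ x≺p = ⊥-elim (nothing-between p p∈ x≺p (adjacent⇒≺ {p} {y} p⋈y))
  ...   | tri< p≺x _ _ = via-right-parent x∈ (≤-trans (s≤s 1≤d) d<q)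
    where
    1≤d : 1 ≤ d
    1≤d = InSF₀⇒1≤den (inj₂ y∈)
    d<q : d < q
    d<q = <-≤-trans (m<n+m d (InSF₀⇒1≤den p∈)) (den-between-adjacent {p} {x} {y} p≺x x≺y p⋈y)
    via-right-parent : InSF₀ Q x → 2 ≤ q → Adjacent x y
    via-right-parent (inj₁ refl) (s≤s ())
    via-right-parent (inj₂ x∈SF) 2≤q with right-parent x∈SF 2≤q
    ... | r , r∈SF , x⋈r with <-cmp (proj₁ r * d) (c * proj₂ r)
    ...   | tri≈ _ r≈y _ = subst (Adjacent x)
              (reduced-unique {proj₁ r} {proj₂ r} (adjacent⇒coprimeʳ {x = x} x⋈r) (InSF₀⇒coprime (inj₂ y∈)) 1≤d r≈y)
              x⋈r
    ...   | tri< r≺y _ _ = ⊥-elim (nothing-between r (inj₂ r∈SF) (adjacent⇒≺ {x} {r} x⋈r) r≺y)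
    ...   | tri> _ _ y≺r = ⊥-elim (<-asym d<q (<-≤-trans (m<m+n q (InSF₀⇒1≤den (inj₂ r∈SF)))
                                                         (den-between-adjacent {x} {y} {r} x≺y y≺r x⋈r)))

  module _ (Q : ℕ) (L : List (ℕ × ℕ)) (iff : ∀ a q → ((a , q) ∈ L) ⇔ InSF Q a q)
           (sorted : Linked ℚ._<_ (map value L)) where

    SF : ℕ × ℕ → Set
    SF z = InSF Q (proj₁ z) (proj₂ z)

    X : List (ℕ × ℕ)
    X = (0 , 1) ∷ L

    ∈X⇔InSF₀ : ∀ z → z ∈ X ⇔ InSF₀ Q z
    ∈X⇔InSF₀ z = mk⇔ to from
      where
      to : z ∈ X → InSF₀ Q z
      to (here refl) = inj₁ refl
      to (there z∈L) = inj₂ (Equivalence.to (iff (proj₁ z) (proj₂ z)) z∈L)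
      from : InSF₀ Q z → z ∈ X
      from (inj₁ refl) = here refl
      from (inj₂ z∈SF) = there (Equivalence.from (iff (proj₁ z) (proj₂ z)) z∈SF)

    SF-L : All SF L
    SF-L = All.tabulate (λ {z} → Equivalence.to (iff (proj₁ z) (proj₂ z)))

    sortedX : AllPairs _<ᵥ_ X
    sortedX = Linked.Linked⇒AllPairs ℚ.<-trans (from-zero SF-L (Linked.map⁻ sorted))
      where
      0<ᵥ : ∀ {y} → SF y → (0 , 1) <ᵥ y
      0<ᵥ {y} ((1≤a , a≤q , _) , _) =
        ≺⇒<ᵥ {0 , 1} {y} (s≤s z≤n) (≤-trans 1≤a a≤q) (≤-trans 1≤a (≤-reflexive (sym (*-identityʳ _))))
      from-zero : ∀ {ys} → All SF ys → Linked _<ᵥ_ ys → Linked _<ᵥ_ ((0 , 1) ∷ ys)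
      from-zero []         _ = [-]
      from-zero (y∈SF ∷ _) l = 0<ᵥ y∈SF ∷ l

    sortedL : AllPairs _<ᵥ_ L
    sortedL = AllPairs.tail sortedX

    adjacentX : Linked Adjacent X
    adjacentX = linked-from-splits X consecutive
      where
      consecutive : ∀ pre {x y} post → X ≡ pre ++ x ∷ y ∷ post → Adjacent x y
      consecutive pre {x} {y} post eq =
        adjacent-if-nothing-between x∈ y∈ (<ᵥ⇒≺ {x} {y} (InSF₀⇒1≤den x∈) (InSF₀⇒1≤den y∈) x<y) nothing-in-X
        where
        sorted′ : AllPairs _<ᵥ_ (pre ++ x ∷ y ∷ post)
        sorted′ = subst (AllPairs _<ᵥ_) eq sortedX
        x∈ : InSF₀ Q x
        x∈ = Equivalence.to (∈X⇔InSF₀ x) (subst (x ∈_) (sym eq) (∈-++⁺ʳ pre (here refl)))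
        y∈ : InSF₀ Q y
        y∈ = Equivalence.to (∈X⇔InSF₀ y) (subst (y ∈_) (sym eq) (∈-++⁺ʳ pre (there (here refl))))
        x<y : x <ᵥ y
        x<y = All.head (AllPairs-after pre sorted′)
        nothing-in-X : ∀ z → InSF₀ Q z → x ≺ z → z ≺ y → ⊥
        nothing-in-X z z∈ x≺z z≺y = nothing-between ℚ.<-asym pre sorted′
          (subst (z ∈_) eq (Equivalence.from (∈X⇔InSF₀ z) z∈))
          (≺⇒<ᵥ {x} {z} (InSF₀⇒1≤den x∈) (InSF₀⇒1≤den z∈) x≺z)
          (≺⇒<ᵥ {z} {y} (InSF₀⇒1≤den z∈) (InSF₀⇒1≤den y∈) z≺y)

    ends-with-one : 3 ≤ Q → ∃ λ ys → L ≡ ys ++ (1 , 1) ∷ []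
    ends-with-one 3≤Q
      with ∈-∃++ (Equivalence.from (iff 1 1) ((s≤s z≤n , s≤s z≤n , Coprime.1-coprimeTo 1) , inj₁ (refl , refl , 3≤Q)))
    ... | ys , []     , eq = ys , eq
    ... | ys , z ∷ zs , eq = ⊥-elim (<⇒≱ one<z (subst₂ _≤_ (sym (*-identityʳ a)) (sym (+-identityʳ q)) a≤q))
      where
      a q : ℕ
      a = proj₁ z
      q = proj₂ z
      z∈SF : SF z
      z∈SF = All.lookup SF-L (subst (z ∈_) (sym eq) (∈-++⁺ʳ ys (there (here refl))))
      a≤q : a ≤ q
      a≤q = proj₁ (proj₂ (proj₁ z∈SF))
      one<z : 1 * q < a * 1
      one<z = <ᵥ⇒≺ {1 , 1} {z} (s≤s z≤n) (InSF₀⇒1≤den (inj₂ z∈SF))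
                (All.head (AllPairs-after ys (subst (AllPairs _<ᵥ_) eq sortedL)))

    SF-chain : ∀ {ys} → L ≡ ys ++ (1 , 1) ∷ [] → Chain ys
    SF-chain {ys} eq = record
      { adjacent = subst (λ T → Linked Adjacent ((0 , 1) ∷ T)) eq adjacentX
      ; interior = All.zipWith (λ (y∈SF , y<1) → den≥2 y∈SF y<1)
                     (All.++⁻ˡ ys (subst (All SF) eq SF-L) , AllPairs-before ys (subst (AllPairs _<ᵥ_) eq sortedL)) }
      where
      den≥2 : ∀ {y} → SF y → y <ᵥ (1 , 1) → 2 ≤ proj₂ y
      den≥2 {a , q} ((1≤a , a≤q , _) , _) y<1 =
        ≤-trans (s≤s 1≤a) (subst₂ _<_ (*-identityʳ a) (+-identityʳ q)
                                   (<ᵥ⇒≺ {a , q} {1 , 1} (≤-trans 1≤a a≤q) (s≤s z≤n) y<1))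

open import Defs
open import Data.Nat using (ℕ; _*_; _∸_; _≥_)
open import Data.Product using (_×_; proj₁; proj₂; _,_)
open import Data.List using (List; map; length)
open import Data.List.Membership.Propositional using (_∈_)
open import Data.List.Relation.Unary.Linked using (Linked)
open import Data.Rational using (_<_)
open import Function.Bundles using (_⇔_)
open import Relation.Binary.PropositionalEquality using (_≡_; refl)
open FareyChains using (chain-sum)
open SortedSF using (ends-with-one; SF-chain)

proposition3 : (Q : ℕ) → Q ≥ 3 → (L : List (ℕ × ℕ))
    → (∀ a q → ((a , q) ∈ L) ⇔ InSF Q a q)
    → Linked _<_ (map (λ p → frac (proj₁ p) (proj₂ p)) L)
    → tripleSum (extendDenoms (map proj₂ L)) ≡ frac (3 * length L ∸ 1) 1
proposition3 Q Q≥3 L iff sorted with ends-with-one Q L iff sorted Q≥3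
... | ys , refl = chain-sum ys (SF-chain Q _ iff sorted refl)
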